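{- Let $r\ge1$ and let $q$ be a connected non-negative unit form of Dynkin type $\mathbb{A}_r$. Then the restriction of the standard morsification $\check{\mathbb{b}}_q$ of $q$ to the radical $\mathrm{rad}(q)$ is a pure bilinear form.
   Context: For a unit form $q:\mathbb{Z}^n\to\mathbb{Z}$ (integral quadratic form with $q(\mathbf{e}_i)=1$), $G_q$ is the symmetric Gram matrix of $q(x+y)-q(x)-q(y)$, $\check G_q$ the upper triangular integer matrix with $q(x)=x^{\mathrm{tr}}\check G_qx$, and the standard morsification is $\check{\mathbb{b}}_q(x,y)=x^{\mathrm{tr}}\check G_qy$. $\mathrm{rad}(q)=\ker G_q$. If $K$ is an $n\times c$ matrix whose columns form a $\mathbb{Z}$-basis of $\mathrm{rad}(q)$, the restriction has Gram matrix $W=K^{\mathrm{tr}}\check G_qK$; it is pure if the image of $W:\mathbb{Z}^c\to\mathbb{Z}^c$ is a pure subgroup (if $ax$ lies in it with $a\ne0$ then so does $x$); this does not depend on the basis. Connected: the graph on $\{1,\dots,n\}$ with edges $i$–$j$ for nonzero coefficients of $x_ix_j$ is connected. Dynkin type: the unique simply-laced Dynkin diagram $\Delta$ with the form induced by $q$ on $\mathbb{Z}^n/\mathrm{rad}(q)$ equivalent to $q_\Delta$, where $G_{q_\Delta}=2\mathrm{Id}-\mathrm{Adj}(\Delta)$. -}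

module Defs where

open import Data.Nat using (ℕ; zero; suc)
open import Data.Fin using (Fin; zero; suc; toℕ; _<_)
open import Data.Integer using (ℤ; 0ℤ; 1ℤ; -1ℤ; _+_; _*_; _≤_)
open import Data.Product using (Σ; _×_; ∃)
open import Relation.Binary.PropositionalEquality using (_≡_; _≢_)
open import Relation.Nullary using (¬_)
open import Function.Bundles using (_⇔_)

Vecℤ : ℕ → Set
Vecℤ n = Fin n → ℤ

Mat : ℕ → ℕ → Set
Mat m n = Fin m → Fin n → ℤ

∑ : ∀ {n} → (Fin n → ℤ) → ℤ
∑ {zero}  f = 0ℤ
∑ {suc n} f = f zero + ∑ (λ i → f (suc i))

_≈_ : ∀ {n} → Vecℤ n → Vecℤ n → Set
u ≈ v = ∀ i → u i ≡ v i

0v : ∀ {n} → Vecℤ n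
0v _ = 0ℤ

_·_ : ∀ {m n} → Mat m n → Vecℤ n → Vecℤ m
(A · x) i = ∑ λ j → A i j * x j

_⊗_ : ∀ {m k n} → Mat m k → Mat k n → Mat m n
(A ⊗ B) i j = ∑ λ l → A i l * B l j

_ᵀ : ∀ {m n} → Mat m n → Mat n m
(A ᵀ) i j = A j i

_⊕_ : ∀ {m n} → Mat m n → Mat m n → Mat m n
(A ⊕ B) i j = A i j + B i j

_•_ : ∀ {n} → ℤ → Vecℤ n → Vecℤ n
(a • x) i = a * x i

bil : ∀ {n} → Mat n n → Vecℤ n → Vecℤ n → ℤ
bil A x y = ∑ λ i → x i * (A · y) i

-- A unit form q : ℤ^n → ℤ, given by its upper triangular matrix Ǧ_q
-- (q(x) = x^tr Ǧ_q x), with q(e_i) = 1, i.e. diagonal entries 1.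
record UnitForm (n : ℕ) : Set where
  field
    Ǧ     : Mat n n
    diag  : ∀ i → Ǧ i i ≡ 1ℤ
    upper : ∀ i j → j < i → Ǧ i j ≡ 0ℤ
open UnitForm public

evalQ : ∀ {n} → UnitForm n → Vecℤ n → ℤ
evalQ q x = bil (Ǧ q) x x

Gram : ∀ {n} → UnitForm n → Mat n n
Gram q = Ǧ q ⊕ (Ǧ q ᵀ)

morsif : ∀ {n} → UnitForm n → Vecℤ n → Vecℤ n → ℤ
morsif q = bil (Ǧ q)

InRad : ∀ {n} → UnitForm n → Vecℤ n → Set
InRad q x = (Gram q · x) ≈ 0v

NonNegative : ∀ {n} → UnitForm n → Set
NonNegative q = ∀ x → 0ℤ ≤ evalQ q x

-- Graph of q: edge i–j (i ≠ j) iff the coefficient of x_i x_j,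
-- namely Ǧ i j + Ǧ j i, is nonzero.
Edge : ∀ {n} → UnitForm n → Fin n → Fin n → Set
Edge q i j = (i ≢ j) × (Ǧ q i j + Ǧ q j i ≢ 0ℤ)

data Reach {n} (q : UnitForm n) : Fin n → Fin n → Set where
  here : ∀ {i} → Reach q i i
  step : ∀ {i j k} → Edge q i j → Reach q j k → Reach q i k

Connected : ∀ {n} → UnitForm n → Set
Connected q = ∀ i j → Reach q i j

-- Upper triangular matrix of q_{A_r}: vertices 0..r-1 on a path,
-- G_{q_A} = 2 Id - Adj(A_r), so Ǧ has 1 on the diagonal and -1 at (i,i+1).
ǦA : (r : ℕ) → Mat r r
ǦA r i j with Data.Nat._≟_ (toℕ i) (toℕ j)
... | Relation.Nullary.yes _ = 1ℤ
... | Relation.Nullary.no _ with Data.Nat._≟_ (suc (toℕ i)) (toℕ j)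
...   | Relation.Nullary.yes _ = -1ℤ
...   | Relation.Nullary.no _ = 0ℤ

qA : (r : ℕ) → Vecℤ r → ℤ
qA r y = bil (ǦA r) y y

-- Dynkin type A_r: the form induced by q on ℤ^n / rad(q) is equivalent to q_{A_r}.
-- An isomorphism ℤ^n/rad(q) ≅ ℤ^r is the same as a surjective ℤ-linear map
-- P : ℤ^n → ℤ^r with kernel exactly rad(q); equivalence of forms means q = q_A ∘ P.
DynkinTypeA : ∀ {n} → UnitForm n → ℕ → Set
DynkinTypeA {n} q r =
  Σ (Mat r n) λ P →
    (∀ (y : Vecℤ r) → ∃ λ (x : Vecℤ n) → (P · x) ≈ y)
  × (∀ (x : Vecℤ n) → ((P · x) ≈ 0v) ⇔ InRad q x)
  × (∀ (x : Vecℤ n) → evalQ q x ≡ qA r (P · x))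

RadBasis : ∀ {n} → UnitForm n → (c : ℕ) → Mat n c → Set
RadBasis {n} q c K =
    (∀ (y : Vecℤ c) → InRad q (K · y))
  × (∀ (y : Vecℤ c) → (K · y) ≈ 0v → y ≈ 0v)
  × (∀ (x : Vecℤ n) → InRad q x → ∃ λ (y : Vecℤ c) → (K · y) ≈ x)

-- Gram matrix of the restriction of b̌_q to rad(q) w.r.t. the basis K.
restrGram : ∀ {n c} → UnitForm n → Mat n c → Mat c c
restrGram q K = (K ᵀ) ⊗ (Ǧ q ⊗ K)

-- A c×c integer matrix W is pure if its image is a pure subgroup of ℤ^c.
PureMat : ∀ {c} → Mat c c → Set
PureMat {c} W =
  ∀ (a : ℤ) (x : Vecℤ c) → a ≢ 0ℤ →
    (∃ λ (y : Vecℤ c) → (W · y) ≈ (a • x)) →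
    ∃ λ (z : Vecℤ c) → (W · z) ≈ x

{-# OPTIONS --safe #-}
-- Let P : ℤⁿ → ℤʳ exhibit q as q_{𝔸_r} ∘ P, and let J : ℤʳ → ℤ^{r+1} send e_i to the root
-- e_i − e_{i+1}, so that |J y|² = 2 q_{𝔸_r}(y).  Then Q = J P satisfies |Q x|² = 2 q(x), hence
-- G_q = QᵀQ, and each column of Q has squared norm 2 and coordinate sum 0, i.e. is a root
-- e_a − e_b.  For the upper unitriangular Ǧ_q this yields the Coxeter identity: Ǧ_q v = Qᵀ w
-- implies Q v = w − w ∘ σ, where σ is a product of transpositions.  Now let W y = a x.  Since
-- rad(q) is a direct summand, Kᵀ g = x for some g; then a g − Ǧ_q K y vanishes on rad(q) and so
-- equals Qᵀ w.  Solving Ǧ_q v₀ = g gives a · Q v₀ = w − w ∘ σ, so w is constant modulo a along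
-- σ and Q v₀ = t − t ∘ σ with t = ⌊w / a⌋.  Solving Ǧ_q v₁ = Qᵀ t gives Q v₁ = t − t ∘ σ as
-- well, so v₀ − v₁ = K z lies in rad(q), and W z = Kᵀ g − (Q K)ᵀ t = x.
module Submission where

open import Defs
open import Data.Nat as ℕ using (ℕ; zero; suc; _≥_; s≤s; z≤n)
open import Data.Nat.Properties as ℕP using ()
open import Data.Bool using (if_then_else_)
open import Data.Fin as F using (Fin; zero; suc; toℕ; inject₁)
open import Data.Fin.Properties as FP using ()
open import Data.Fin.Permutation.Components using (transpose)
open import Data.Integer as ℤ using (ℤ; 0ℤ; 1ℤ; -1ℤ; _+_; _*_; -_; _-_; ∣_∣; _◃_; _/_; _%_; NonZero)
open import Data.Integer.Properties as ℤP using ()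
open import Data.Integer.DivMod using (a≡a%n+[a/n]*n; n%d<d)
open import Data.Integer.Tactic.RingSolver using (solve-∀)
open import Data.Sign as Sign using (Sign)
open import Data.Vec as V using (Vec; []; _∷_)
open import Data.Product using (Σ; ∃; ∃₂; _×_; _,_; proj₁; proj₂; map₂)
open import Data.Empty using (⊥-elim)
open import Function using (_∘_; id)
open import Relation.Binary.PropositionalEquality using (_≡_; _≢_; refl; sym; trans; cong; cong₂; module ≡-Reasoning)
open import Relation.Nullary using (Dec; does; yes; no)
open import Relation.Nullary.Decidable using (dec-true; dec-false)
open import Function.Bundles using (Equivalence)

∑-cong : ∀ {n} {f g : Fin n → ℤ} → (∀ i → f i ≡ g i) → ∑ f ≡ ∑ g
∑-cong {zero}  f≗g = refl
∑-cong {suc n} f≗g = cong₂ _+_ (f≗g zero) (∑-cong (f≗g ∘ suc))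

∑-zero : ∀ {n} {f : Fin n → ℤ} → (∀ i → f i ≡ 0ℤ) → ∑ f ≡ 0ℤ
∑-zero {zero}  f≗0 = refl
∑-zero {suc n} f≗0 = cong₂ _+_ (f≗0 zero) (∑-zero (f≗0 ∘ suc))

∑-+ : ∀ {n} (f g : Fin n → ℤ) → ∑ (λ i → f i + g i) ≡ ∑ f + ∑ g
∑-+ {zero}  f g = refl
∑-+ {suc n} f g = begin
  (f zero + g zero) + ∑ (λ i → f (suc i) + g (suc i)) ≡⟨ cong ((f zero + g zero) +_) (∑-+ (f ∘ suc) (g ∘ suc)) ⟩
  (f zero + g zero) + (∑ (f ∘ suc) + ∑ (g ∘ suc))     ≡⟨ +-interchange (f zero) (g zero) (∑ (f ∘ suc)) (∑ (g ∘ suc)) ⟩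
  (f zero + ∑ (f ∘ suc)) + (g zero + ∑ (g ∘ suc))     ∎
  where
  open ≡-Reasoning
  +-interchange : ∀ a b c d → (a + b) + (c + d) ≡ (a + c) + (b + d)
  +-interchange = solve-∀

∑-*ˡ : ∀ {n} (a : ℤ) (f : Fin n → ℤ) → ∑ (λ i → a * f i) ≡ a * ∑ f
∑-*ˡ {zero}  a f = sym (ℤP.*-zeroʳ a)
∑-*ˡ {suc n} a f = trans (cong (a * f zero +_) (∑-*ˡ a (f ∘ suc))) (sym (ℤP.*-distribˡ-+ a (f zero) _))

∑-*ʳ : ∀ {n} (a : ℤ) (f : Fin n → ℤ) → ∑ (λ i → f i * a) ≡ ∑ f * a
∑-*ʳ a f = begin
  ∑ (λ i → f i * a) ≡⟨ ∑-cong (λ i → ℤP.*-comm (f i) a) ⟩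
  ∑ (λ i → a * f i) ≡⟨ ∑-*ˡ a f ⟩
  a * ∑ f           ≡⟨ ℤP.*-comm a (∑ f) ⟩
  ∑ f * a           ∎
  where open ≡-Reasoning

∑-neg : ∀ {n} (f : Fin n → ℤ) → ∑ (λ i → - f i) ≡ - ∑ f
∑-neg {zero}  f = refl
∑-neg {suc n} f = trans (cong (- f zero +_) (∑-neg (f ∘ suc))) (sym (ℤP.neg-distrib-+ (f zero) _))

∑-- : ∀ {n} (f g : Fin n → ℤ) → ∑ (λ i → f i - g i) ≡ ∑ f - ∑ g
∑-- f g = trans (∑-+ f (λ i → - g i)) (cong (∑ f +_) (∑-neg g))

∑-comm : ∀ {m n} (f : Fin m → Fin n → ℤ) → ∑ (λ i → ∑ (f i)) ≡ ∑ (λ j → ∑ (λ i → f i j))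
∑-comm {zero} {n} f = sym (∑-zero {n} (λ _ → refl))
∑-comm {suc m} f = trans (cong (∑ (f zero) +_) (∑-comm (f ∘ suc))) (sym (∑-+ (f zero) _))

δℕ : ℕ → ℕ → ℤ
δℕ m n = if does (m ℕ.≟ n) then 1ℤ else 0ℤ

δℕ-≡ : ∀ {m n} → m ≡ n → δℕ m n ≡ 1ℤ
δℕ-≡ {m} {n} m≡n rewrite dec-true (m ℕ.≟ n) m≡n = refl

δℕ-≢ : ∀ {m n} → m ≢ n → δℕ m n ≡ 0ℤ
δℕ-≢ {m} {n} m≢n rewrite dec-false (m ℕ.≟ n) m≢n = refl

δℕ-sym : ∀ m n → δℕ m n ≡ δℕ n m
δℕ-sym m n with m ℕ.≟ n
... | yes refl = refl
... | no m≢n   = trans (δℕ-≢ m≢n) (sym (δℕ-≢ (m≢n ∘ sym)))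

δ : ∀ {N} → Fin N → Fin N → ℤ
δ k l = δℕ (toℕ k) (toℕ l)

δ-refl : ∀ {N} (k : Fin N) → δ k k ≡ 1ℤ
δ-refl k = δℕ-≡ {toℕ k} refl

δ-≢ : ∀ {N} {k l : Fin N} → k ≢ l → δ k l ≡ 0ℤ
δ-≢ k≢l = δℕ-≢ (k≢l ∘ FP.toℕ-injective)

δ-sym : ∀ {N} (k l : Fin N) → δ k l ≡ δ l k
δ-sym k l = δℕ-sym (toℕ k) (toℕ l)

e : ∀ {N} → Fin N → Vecℤ N
e l k = δ k l

∑-δʳ : ∀ {N} (f : Fin N → ℤ) (l : Fin N) → ∑ (λ k → f k * δ k l) ≡ f l
∑-δʳ f zero = begin
  f zero * 1ℤ + ∑ (λ k → f (suc k) * 0ℤ) ≡⟨ cong₂ _+_ (ℤP.*-identityʳ (f zero)) (∑-zero (λ k → ℤP.*-zeroʳ (f (suc k)))) ⟩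
  f zero + 0ℤ                            ≡⟨ ℤP.+-identityʳ (f zero) ⟩
  f zero                                 ∎
  where open ≡-Reasoning
∑-δʳ f (suc l) = trans (cong₂ _+_ (ℤP.*-zeroʳ (f zero)) (∑-δʳ (f ∘ suc) l)) (ℤP.+-identityˡ (f (suc l)))

∑-δˡ : ∀ {N} (f : Fin N → ℤ) (l : Fin N) → ∑ (λ k → δ k l * f k) ≡ f l
∑-δˡ f l = trans (∑-cong (λ k → ℤP.*-comm (δ k l) (f k))) (∑-δʳ f l)

∑-e : ∀ {N} (a : Fin N) → ∑ (e a) ≡ 1ℤ
∑-e a = trans (∑-cong (λ k → sym (ℤP.*-identityˡ (δ k a)))) (∑-δʳ (λ _ → 1ℤ) a)

infixl 6 _+ᵛ_ _-ᵛ_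

_+ᵛ_ : ∀ {N} → Vecℤ N → Vecℤ N → Vecℤ N
(u +ᵛ v) i = u i + v i

_-ᵛ_ : ∀ {N} → Vecℤ N → Vecℤ N → Vecℤ N
(u -ᵛ v) i = u i - v i

-- `(A · x) i`, `bil A x y` and `((A ᵀ) ⊗ B) i j` unfold to `dot (A i) x`, `dot x (A · y)` and
-- `dot (column A i) (column B j)`; the proofs below use these unfoldings silently.
dot : ∀ {N} → Vecℤ N → Vecℤ N → ℤ
dot u v = ∑ (λ i → u i * v i)

dot-comm : ∀ {N} (u v : Vecℤ N) → dot u v ≡ dot v u
dot-comm u v = ∑-cong (λ i → ℤP.*-comm (u i) (v i))

dot-cong : ∀ {N} {u u′ v v′ : Vecℤ N} → u ≈ u′ → v ≈ v′ → dot u v ≡ dot u′ v′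
dot-cong u≈u′ v≈v′ = ∑-cong (λ i → cong₂ _*_ (u≈u′ i) (v≈v′ i))

dot-congʳ : ∀ {N} (u : Vecℤ N) {v v′ : Vecℤ N} → v ≈ v′ → dot u v ≡ dot u v′
dot-congʳ u = dot-cong {u = u} (λ _ → refl)

dot-+ʳ : ∀ {N} (u v w : Vecℤ N) → dot u (v +ᵛ w) ≡ dot u v + dot u w
dot-+ʳ u v w = trans (∑-cong (λ i → ℤP.*-distribˡ-+ (u i) (v i) (w i))) (∑-+ (λ i → u i * v i) (λ i → u i * w i))

dot-+ˡ : ∀ {N} (u v w : Vecℤ N) → dot (u +ᵛ v) w ≡ dot u w + dot v w
dot-+ˡ u v w = trans (∑-cong (λ i → ℤP.*-distribʳ-+ (w i) (u i) (v i))) (∑-+ (λ i → u i * w i) (λ i → v i * w i))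

dot--ʳ : ∀ {N} (u v w : Vecℤ N) → dot u (v -ᵛ w) ≡ dot u v - dot u w
dot--ʳ u v w = trans (∑-cong (λ i → *-distribˡ-- (u i) (v i) (w i))) (∑-- (λ i → u i * v i) (λ i → u i * w i))
  where
  *-distribˡ-- : ∀ a b c → a * (b - c) ≡ a * b - a * c
  *-distribˡ-- = solve-∀

dot-•ʳ : ∀ {N} (a : ℤ) (u v : Vecℤ N) → dot u (a • v) ≡ a * dot u v
dot-•ʳ a u v = trans (∑-cong (λ i → *-left-comm (u i) a (v i))) (∑-*ˡ a (λ i → u i * v i))
  where
  *-left-comm : ∀ x y z → x * (y * z) ≡ y * (x * z)
  *-left-comm = solve-∀

dot-0ʳ : ∀ {N} (u : Vecℤ N) → dot u 0v ≡ 0ℤ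
dot-0ʳ u = ∑-zero (λ i → ℤP.*-zeroʳ (u i))

dot-0ˡ : ∀ {N} (u : Vecℤ N) → dot 0v u ≡ 0ℤ
dot-0ˡ u = trans (dot-comm 0v u) (dot-0ʳ u)

dot-eʳ : ∀ {N} (u : Vecℤ N) (l : Fin N) → dot u (e l) ≡ u l
dot-eʳ = ∑-δʳ

dot-eˡ : ∀ {N} (u : Vecℤ N) (l : Fin N) → dot (e l) u ≡ u l
dot-eˡ = ∑-δˡ

dot-·-assoc : ∀ {m n} (a : Vecℤ m) (M : Mat m n) (b : Vecℤ n) →
  dot a (M · b) ≡ dot (λ j → ∑ (λ i → a i * M i j)) b
dot-·-assoc a M b = begin
  ∑ (λ i → a i * ∑ (λ j → M i j * b j))   ≡⟨ ∑-cong (λ i → sym (∑-*ˡ (a i) (λ j → M i j * b j))) ⟩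
  ∑ (λ i → ∑ (λ j → a i * (M i j * b j))) ≡⟨ ∑-comm (λ i j → a i * (M i j * b j)) ⟩
  ∑ (λ j → ∑ (λ i → a i * (M i j * b j))) ≡⟨ ∑-cong (λ j → ∑-cong (λ i → sym (ℤP.*-assoc (a i) (M i j) (b j)))) ⟩
  ∑ (λ j → ∑ (λ i → a i * M i j * b j))   ≡⟨ ∑-cong (λ j → ∑-*ʳ (b j) (λ i → a i * M i j)) ⟩
  ∑ (λ j → ∑ (λ i → a i * M i j) * b j)   ∎
  where open ≡-Reasoning

column : ∀ {m n} → Mat m n → Fin n → Vecℤ m
column A j i = A i j

·-cong : ∀ {m n} (A : Mat m n) {x y : Vecℤ n} → x ≈ y → (A · x) ≈ (A · y)
·-cong A x≈y i = dot-congʳ (A i) x≈y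

·-congᴹ : ∀ {m n} {A B : Mat m n} → (∀ i j → A i j ≡ B i j) → ∀ x → (A · x) ≈ (B · x)
·-congᴹ A≡B x i = dot-cong (A≡B i) (λ _ → refl)

·-+ : ∀ {m n} (A : Mat m n) (x y : Vecℤ n) → (A · (x +ᵛ y)) ≈ ((A · x) +ᵛ (A · y))
·-+ A x y i = dot-+ʳ (A i) x y

·-- : ∀ {m n} (A : Mat m n) (x y : Vecℤ n) → (A · (x -ᵛ y)) ≈ ((A · x) -ᵛ (A · y))
·-- A x y i = dot--ʳ (A i) x y

·-• : ∀ {m n} (A : Mat m n) (a : ℤ) (x : Vecℤ n) → (A · (a • x)) ≈ (a • (A · x))
·-• A a x i = dot-•ʳ a (A i) x

·-0 : ∀ {m n} (A : Mat m n) → (A · 0v) ≈ 0v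
·-0 A i = dot-0ʳ (A i)

·-e : ∀ {m n} (A : Mat m n) (j : Fin n) → (A · e j) ≈ column A j
·-e A j i = dot-eʳ (A i) j

·-⊕ : ∀ {m n} (A B : Mat m n) (x : Vecℤ n) → ((A ⊕ B) · x) ≈ ((A · x) +ᵛ (B · x))
·-⊕ A B x i = dot-+ˡ (A i) (B i) x

⊗-· : ∀ {m k n} (A : Mat m k) (B : Mat k n) (x : Vecℤ n) → ((A ⊗ B) · x) ≈ (A · (B · x))
⊗-· A B x i = sym (dot-·-assoc (A i) B x)

dot-ᵀ : ∀ {m n} (A : Mat m n) (u : Vecℤ m) (v : Vecℤ n) → dot u (A · v) ≡ dot ((A ᵀ) · u) v
dot-ᵀ A u v = trans (dot-·-assoc u A v) (dot-cong (λ j → ∑-cong (λ i → ℤP.*-comm (u i) (A i j))) (λ _ → refl))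

ᵀ-· : ∀ {m n} (A : Mat m n) (u : Vecℤ m) (j : Fin n) → ((A ᵀ) · u) j ≡ dot (A · e j) u
ᵀ-· A u j = dot-cong (λ i → sym (·-e A j i)) (λ _ → refl)

ᵀ-⊗-· : ∀ {m k n} (A : Mat m k) (B : Mat k n) (u : Vecℤ m) → (((A ⊗ B) ᵀ) · u) ≈ ((B ᵀ) · ((A ᵀ) · u))
ᵀ-⊗-· A B u j = begin
  (((A ⊗ B) ᵀ) · u) j             ≡⟨ ᵀ-· (A ⊗ B) u j ⟩
  dot ((A ⊗ B) · e j) u           ≡⟨ dot-cong (⊗-· A B (e j)) (λ _ → refl) ⟩
  dot (A · (B · e j)) u           ≡⟨ dot-comm (A · (B · e j)) u ⟩
  dot u (A · (B · e j))           ≡⟨ dot-ᵀ A u (B · e j) ⟩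
  dot ((A ᵀ) · u) (B · e j)       ≡⟨ dot-ᵀ B ((A ᵀ) · u) (e j) ⟩
  dot ((B ᵀ) · ((A ᵀ) · u)) (e j) ≡⟨ dot-eʳ ((B ᵀ) · ((A ᵀ) · u)) j ⟩
  ((B ᵀ) · ((A ᵀ) · u)) j         ∎
  where open ≡-Reasoning

-- Unitriangular systems and the Coxeter identity

UnitUpperTriangular : ∀ {n} → Mat n n → Set
UnitUpperTriangular G = (∀ i → G i i ≡ 1ℤ) × (∀ i j → j F.< i → G i j ≡ 0ℤ)

trailing : ∀ {n} → Mat (suc n) (suc n) → Mat n n
trailing G i j = G (suc i) (suc j)

module _ {n : ℕ} {G : Mat (suc n) (suc n)} (G-unit : UnitUpperTriangular G) where

  trailing-unitUpper : UnitUpperTriangular (trailing G)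
  trailing-unitUpper = (λ i → proj₁ G-unit (suc i)) , (λ i j j<i → proj₂ G-unit (suc i) (suc j) (s≤s j<i))

  unitUpper-·-head : ∀ v → (G · v) zero ≡ v zero + dot (λ j → G zero (suc j)) (v ∘ suc)
  unitUpper-·-head v =
    cong (_+ dot (λ j → G zero (suc j)) (v ∘ suc))
         (trans (cong (_* v zero) (proj₁ G-unit zero)) (ℤP.*-identityˡ (v zero)))

  unitUpper-·-tail : ∀ v i → (G · v) (suc i) ≡ (trailing G · (v ∘ suc)) i
  unitUpper-·-tail v i =
    trans (cong (_+ (trailing G · (v ∘ suc)) i)
                (trans (cong (_* v zero) (proj₂ G-unit (suc i) zero (s≤s z≤n))) (ℤP.*-zeroˡ (v zero))))
          (ℤP.+-identityˡ ((trailing G · (v ∘ suc)) i))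

unitUpper-solve : ∀ {n} (G : Mat n n) → UnitUpperTriangular G → ∀ g → ∃ λ v → (G · v) ≈ g
unitUpper-solve {zero}  G G-unit g = 0v , λ ()
unitUpper-solve {suc n} G G-unit g = v , G·v≈g
  where
  rest = unitUpper-solve (trailing G) (trailing-unitUpper G-unit) (g ∘ suc)
  s = dot (λ j → G zero (suc j)) (proj₁ rest)
  v : Vecℤ (suc n)
  v zero    = g zero - s
  v (suc j) = proj₁ rest j
  G·v≈g : (G · v) ≈ g
  G·v≈g zero    = trans (unitUpper-·-head G-unit v) (minus-plus (g zero) s)
    where
    minus-plus : ∀ a b → a - b + b ≡ a
    minus-plus = solve-∀
  G·v≈g (suc i) = trans (unitUpper-·-tail G-unit v i) (proj₂ rest i)

reflect : ∀ {N} → Vecℤ N → Vecℤ N → Vecℤ N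
reflect d u = u -ᵛ (dot d u • d)

coxeter : ∀ {N n} → Mat N n → Vecℤ N → Vecℤ N
coxeter {n = zero}  D w = w
coxeter {n = suc n} D w = reflect (column D zero) (coxeter (λ k j → D k (suc j)) w)

coxeter-identity : ∀ {N n} (G : Mat n n) → UnitUpperTriangular G → (D : Mat N n) →
  (∀ i j → i F.< j → G i j ≡ ((D ᵀ) ⊗ D) i j) →
  ∀ v w → (G · v) ≈ ((D ᵀ) · w) → (D · v) ≈ (w -ᵛ coxeter D w)
coxeter-identity {n = zero}  G G-unit D G≡DᵀD v w Gv≈Dᵀw k = sym (ℤP.+-inverseʳ (w k))
coxeter-identity {n = suc n} G G-unit D G≡DᵀD v w Gv≈Dᵀw k = begin
  d k * v zero + (D′ · v′) k                   ≡⟨ cong₂ (λ s t → d k * s + t) v₀≡ (IH k) ⟩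
  d k * dot d u + (w k - u k)                  ≡⟨ rearrange (d k) (dot d u) (w k) (u k) ⟩
  w k - (u k - dot d u * d k)                  ∎
  where
  open ≡-Reasoning
  d = column D zero
  D′ : Mat _ n
  D′ k j = D k (suc j)
  v′ = v ∘ suc
  u = coxeter D′ w
  IH : (D′ · v′) ≈ (w -ᵛ u)
  IH = coxeter-identity (trailing G) (trailing-unitUpper G-unit) D′
         (λ i j i<j → G≡DᵀD (suc i) (suc j) (s≤s i<j)) v′ w
         (λ i → trans (sym (unitUpper-·-tail G-unit v i)) (Gv≈Dᵀw (suc i)))
  -- Row 0 of G v ≈ Dᵀ w reads v₀ + ⟨d, D′ v′⟩ = ⟨d, w⟩; by induction this makes v₀ the
  -- coefficient ⟨d, u⟩ of the reflection in d applied to u = coxeter D′ w.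
  v₀≡ : v zero ≡ dot d u
  v₀≡ = begin
    v zero                                    ≡⟨ plus-minus (v zero) (dot d (D′ · v′)) ⟩
    (v zero + dot d (D′ · v′)) - dot d (D′ · v′)
      ≡⟨ cong (λ s → (v zero + s) - dot d (D′ · v′))
              (trans (dot-·-assoc d D′ v′) (dot-cong (λ j → sym (G≡DᵀD zero (suc j) (s≤s z≤n))) (λ _ → refl))) ⟩
    (v zero + dot (λ j → G zero (suc j)) v′) - dot d (D′ · v′)
      ≡⟨ cong (_- dot d (D′ · v′)) (trans (sym (unitUpper-·-head G-unit v)) (Gv≈Dᵀw zero)) ⟩
    dot d w - dot d (D′ · v′)                 ≡⟨ sym (dot--ʳ d w (D′ · v′)) ⟩
    dot d (w -ᵛ (D′ · v′))                    ≡⟨ dot-congʳ d (λ l → trans (cong (λ s → w l - s) (IH l)) (minus-minus (w l) (u l))) ⟩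
    dot d u                                   ∎
    where
    plus-minus : ∀ a b → a ≡ (a + b) - b
    plus-minus = solve-∀
    minus-minus : ∀ a b → a - (a - b) ≡ b
    minus-minus = solve-∀
  rearrange : ∀ a b c x → a * b + (c - x) ≡ c - (x - b * a)
  rearrange = solve-∀

-- Roots and transpositions

transpose-matchˡ : ∀ {N} (i j : Fin N) → transpose i j i ≡ j
transpose-matchˡ i j rewrite dec-true (i F.≟ i) refl = refl

transpose-matchʳ : ∀ {N} (i j : Fin N) → transpose i j j ≡ i
transpose-matchʳ i j with j F.≟ i
... | yes j≡i = j≡i
... | no  _   rewrite dec-true (j F.≟ j) refl = refl

transpose-other : ∀ {N} {i j k : Fin N} → k ≢ i → k ≢ j → transpose i j k ≡ k
transpose-other {i = i} {j} {k} k≢i k≢j rewrite dec-false (k F.≟ i) k≢i | dec-false (k F.≟ j) k≢j = refl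

root : ∀ {N} → Fin N → Fin N → Vecℤ N
root a b = e a -ᵛ e b

dot-rootˡ : ∀ {N} (a b : Fin N) (u : Vecℤ N) → dot (root a b) u ≡ u a - u b
dot-rootˡ a b u = begin
  dot (e a -ᵛ e b) u      ≡⟨ dot-comm (e a -ᵛ e b) u ⟩
  dot u (e a -ᵛ e b)      ≡⟨ dot--ʳ u (e a) (e b) ⟩
  dot u (e a) - dot u (e b) ≡⟨ cong₂ _-_ (dot-eʳ u a) (dot-eʳ u b) ⟩
  u a - u b               ∎
  where open ≡-Reasoning

reflect-cong : ∀ {N} (d : Vecℤ N) {u u′ : Vecℤ N} → u ≈ u′ → reflect d u ≈ reflect d u′
reflect-cong d u≈u′ k = cong₂ (λ s t → s - t * d k) (u≈u′ k) (dot-congʳ d u≈u′)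

reflect-root : ∀ {N} (a b : Fin N) (u : Vecℤ N) → reflect (root a b) u ≈ (u ∘ transpose a b)
reflect-root a b u k = trans (cong (λ s → u k - s * (δ k a - δ k b)) (dot-rootˡ a b u)) (cases (k F.≟ a) (k F.≟ b))
  where
  open ≡-Reasoning
  cases : Dec (k ≡ a) → Dec (k ≡ b) → u k - (u a - u b) * (δ k a - δ k b) ≡ u (transpose a b k)
  cases (yes refl) (yes refl) = begin
    u k - (u k - u k) * (δ k k - δ k k)   ≡⟨ vanish (u k) (δ k k - δ k k) ⟩
    u k                                   ≡⟨ cong u (sym (transpose-matchˡ k k)) ⟩
    u (transpose k k k)                   ∎
    where
    vanish : ∀ x y → x - (x - x) * y ≡ x
    vanish = solve-∀
  cases (yes refl) (no k≢b) = begin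
    u k - (u k - u b) * (δ k k - δ k b)   ≡⟨ cong₂ (λ s t → u k - (u k - u b) * (s - t)) (δ-refl k) (δ-≢ k≢b) ⟩
    u k - (u k - u b) * (1ℤ - 0ℤ)         ≡⟨ swap₁ (u k) (u b) ⟩
    u b                                   ≡⟨ cong u (sym (transpose-matchˡ k b)) ⟩
    u (transpose k b k)                   ∎
    where
    swap₁ : ∀ x y → x - (x - y) * (1ℤ - 0ℤ) ≡ y
    swap₁ = solve-∀
  cases (no k≢a) (yes refl) = begin
    u k - (u a - u k) * (δ k a - δ k k)   ≡⟨ cong₂ (λ s t → u k - (u a - u k) * (s - t)) (δ-≢ k≢a) (δ-refl k) ⟩
    u k - (u a - u k) * (0ℤ - 1ℤ)         ≡⟨ swap₂ (u a) (u k) ⟩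
    u a                                   ≡⟨ cong u (sym (transpose-matchʳ a k)) ⟩
    u (transpose a k k)                   ∎
    where
    swap₂ : ∀ x y → y - (x - y) * (0ℤ - 1ℤ) ≡ x
    swap₂ = solve-∀
  cases (no k≢a) (no k≢b) = begin
    u k - (u a - u b) * (δ k a - δ k b)   ≡⟨ cong₂ (λ s t → u k - (u a - u b) * (s - t)) (δ-≢ k≢a) (δ-≢ k≢b) ⟩
    u k - (u a - u b) * (0ℤ - 0ℤ)         ≡⟨ fix (u k) (u a - u b) ⟩
    u k                                   ≡⟨ cong u (sym (transpose-other k≢a k≢b)) ⟩
    u (transpose a b k)                   ∎
    where
    fix : ∀ x y → x - y * (0ℤ - 0ℤ) ≡ x
    fix = solve-∀

rootMatrix : ∀ {N n} → (Fin n → Fin N × Fin N) → Mat N n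
rootMatrix ab k i = root (proj₁ (ab i)) (proj₂ (ab i)) k

rootPerm : ∀ {N n} → (Fin n → Fin N × Fin N) → Fin N → Fin N
rootPerm {n = zero}  ab = id
rootPerm {n = suc n} ab = rootPerm (ab ∘ suc) ∘ transpose (proj₁ (ab zero)) (proj₂ (ab zero))

coxeter-rootMatrix : ∀ {N n} (ab : Fin n → Fin N × Fin N) (w : Vecℤ N) →
  coxeter (rootMatrix ab) w ≈ (w ∘ rootPerm ab)
coxeter-rootMatrix {n = zero}  ab w k = refl
coxeter-rootMatrix {n = suc n} ab w k =
  trans (reflect-cong (root a b) (coxeter-rootMatrix (ab ∘ suc) w) k)
        (reflect-root a b (w ∘ rootPerm (ab ∘ suc)) k)
  where
  a = proj₁ (ab zero)
  b = proj₂ (ab zero)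

∑-root : ∀ {N} (a b : Fin N) → ∑ (root a b) ≡ 0ℤ
∑-root a b = trans (∑-cong (λ k → sym (ℤP.*-identityʳ (root a b k))))
                   (trans (dot-rootˡ a b (λ _ → 1ℤ)) (ℤP.+-inverseʳ 1ℤ))

∑-rootMatrix-· : ∀ {N n} (ab : Fin n → Fin N × Fin N) (y : Vecℤ n) → ∑ (rootMatrix ab · y) ≡ 0ℤ
∑-rootMatrix-· ab y = begin
  ∑ (rootMatrix ab · y)                                    ≡⟨ ∑-cong (λ k → sym (ℤP.*-identityˡ ((rootMatrix ab · y) k))) ⟩
  dot (λ _ → 1ℤ) (rootMatrix ab · y)                       ≡⟨ dot-·-assoc (λ _ → 1ℤ) (rootMatrix ab) y ⟩
  dot (λ j → ∑ (λ k → 1ℤ * rootMatrix ab k j)) y           ≡⟨ dot-cong column-sums (λ _ → refl) ⟩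
  dot 0v y                                                 ≡⟨ dot-0ˡ y ⟩
  0ℤ                                                       ∎
  where
  open ≡-Reasoning
  column-sums : ∀ j → ∑ (λ k → 1ℤ * rootMatrix ab k j) ≡ 0ℤ
  column-sums j = trans (∑-cong (λ k → ℤP.*-identityˡ (rootMatrix ab k j))) (∑-root (proj₁ (ab j)) (proj₂ (ab j)))

-- Integer vectors of squared norm two

normℕ : ∀ {N} → Vecℤ N → ℕ
normℕ {zero}  d = 0
normℕ {suc N} d = ∣ d zero ∣ ℕ.* ∣ d zero ∣ ℕ.+ normℕ (d ∘ suc)

dot-self : ∀ {N} (d : Vecℤ N) → dot d d ≡ ℤ.+ normℕ d
dot-self {zero}  d = refl
dot-self {suc N} d = cong₂ _+_ (square (d zero)) (dot-self (d ∘ suc))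
  where
  square : ∀ x → x * x ≡ ℤ.+ (∣ x ∣ ℕ.* ∣ x ∣)
  square (ℤ.+ n)    = ℤP.+◃n≡+n (n ℕ.* n)
  square ℤ.-[1+ n ] = refl

4≤square : ∀ n → 4 ℕ.≤ suc (suc n) ℕ.* suc (suc n)
4≤square n = ℕP.*-mono-≤ {2} {suc (suc n)} {2} {suc (suc n)} 2≤ 2≤
  where 2≤ = s≤s (s≤s z≤n)

data SquareView : ℤ → Set where
  zero  : SquareView 0ℤ
  unit  : ∀ s → SquareView (s ◃ 1)
  large : ∀ {x} → 4 ℕ.≤ ∣ x ∣ ℕ.* ∣ x ∣ → SquareView x

squareView : ∀ x → SquareView x
squareView (ℤ.+ 0)            = zero
squareView (ℤ.+ 1)            = unit Sign.+
squareView (ℤ.+ suc (suc n))  = large (4≤square n)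
squareView ℤ.-[1+ 0 ]         = unit Sign.-
squareView ℤ.-[1+ suc n ]     = large (4≤square n)

signedSum : ∀ {N m} → Vec (Sign × Fin N) m → Vecℤ N
signedSum []            = 0v
signedSum ((s , a) ∷ ts) = ((s ◃ 1) • e a) +ᵛ signedSum ts

shift : ∀ {N m} → Vec (Sign × Fin N) m → Vec (Sign × Fin (suc N)) m
shift = V.map (map₂ suc)

signedSum-shift-zero : ∀ {N m} (ts : Vec (Sign × Fin N) m) → signedSum (shift ts) zero ≡ 0ℤ
signedSum-shift-zero []            = refl
signedSum-shift-zero ((s , a) ∷ ts) =
  trans (cong₂ _+_ (ℤP.*-zeroʳ (s ◃ 1)) (signedSum-shift-zero ts)) refl

signedSum-shift-suc : ∀ {N m} (ts : Vec (Sign × Fin N) m) k → signedSum (shift ts) (suc k) ≡ signedSum ts k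
signedSum-shift-suc []            k = refl
signedSum-shift-suc ((s , a) ∷ ts) k = cong ((s ◃ 1) * δ k a +_) (signedSum-shift-suc ts k)

signed-unit-decomposition : ∀ {N m} (d : Vecℤ N) → normℕ d ≡ m → m ℕ.< 4 →
  Σ (Vec (Sign × Fin N) m) λ ts → d ≈ signedSum ts
signed-unit-decomposition {zero}  d refl m<4 = [] , λ ()
signed-unit-decomposition {suc N} d ‖d‖≡m m<4 = extend (squareView (d zero)) refl ‖d‖≡m m<4
  where
  d′ = d ∘ suc
  extendUnit : ∀ {m} s → d zero ≡ s ◃ 1 → suc (normℕ d′) ≡ m → m ℕ.< 4 →
    Σ (Vec (Sign × Fin (suc N)) m) λ ts → d ≈ signedSum ts
  extendUnit s d₀≡s refl m<4 = (s , zero) ∷ shift ts , d≈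
    where
    rest = signed-unit-decomposition d′ refl (ℕP.<-trans (ℕP.n<1+n (normℕ d′)) m<4)
    ts = proj₁ rest
    d≈ : d ≈ signedSum ((s , zero) ∷ shift ts)
    d≈ zero    = sym (trans (cong₂ _+_ (trans (cong ((s ◃ 1) *_) (δ-refl {suc N} zero)) (ℤP.*-identityʳ (s ◃ 1)))
                                       (signedSum-shift-zero ts))
                            (trans (ℤP.+-identityʳ (s ◃ 1)) (sym d₀≡s)))
    d≈ (suc k) = sym (trans (cong₂ _+_ (ℤP.*-zeroʳ (s ◃ 1)) (signedSum-shift-suc ts k))
                            (trans (ℤP.+-identityˡ (signedSum ts k)) (sym (proj₂ rest k))))
  extend : ∀ {x m} → SquareView x → d zero ≡ x → ∣ x ∣ ℕ.* ∣ x ∣ ℕ.+ normℕ d′ ≡ m → m ℕ.< 4 →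
    Σ (Vec (Sign × Fin (suc N)) m) λ ts → d ≈ signedSum ts
  extend zero d₀≡0 refl m<4 = shift ts , d≈
    where
    rest = signed-unit-decomposition d′ refl m<4
    ts = proj₁ rest
    d≈ : d ≈ signedSum (shift ts)
    d≈ zero    = trans d₀≡0 (sym (signedSum-shift-zero ts))
    d≈ (suc k) = trans (proj₂ rest k) (sym (signedSum-shift-suc ts k))
  extend (unit s) d₀≡s ‖d‖≡m m<4 =
    extendUnit s d₀≡s (trans (cong (λ k → k ℕ.* k ℕ.+ normℕ d′) (sym (ℤP.abs-◃ s 1))) ‖d‖≡m) m<4
  extend (large 4≤x²) _ ‖d‖≡m m<4 =
    ⊥-elim (ℕP.<⇒≱ m<4 (ℕP.≤-trans 4≤x² (ℕP.≤-trans (ℕP.m≤m+n _ (normℕ d′)) (ℕP.≤-reflexive ‖d‖≡m))))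

∑-signed-e : ∀ {N} (s : Sign) (a : Fin N) → ∑ ((s ◃ 1) • e a) ≡ s ◃ 1
∑-signed-e s a = begin
  ∑ (λ k → (s ◃ 1) * δ k a) ≡⟨ ∑-*ˡ (s ◃ 1) (e a) ⟩
  (s ◃ 1) * ∑ (e a)         ≡⟨ cong ((s ◃ 1) *_) (∑-e a) ⟩
  (s ◃ 1) * 1ℤ              ≡⟨ ℤP.*-identityʳ (s ◃ 1) ⟩
  s ◃ 1                     ∎
  where open ≡-Reasoning

∑-signedSum₂ : ∀ {N} s (a : Fin N) t b → ∑ (signedSum ((s , a) ∷ (t , b) ∷ [])) ≡ (s ◃ 1) + ((t ◃ 1) + 0ℤ)
∑-signedSum₂ {N} s a t b = begin
  ∑ (((s ◃ 1) • e a) +ᵛ (((t ◃ 1) • e b) +ᵛ 0v))         ≡⟨ ∑-+ ((s ◃ 1) • e a) (((t ◃ 1) • e b) +ᵛ 0v) ⟩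
  ∑ ((s ◃ 1) • e a) + ∑ (((t ◃ 1) • e b) +ᵛ 0v)          ≡⟨ cong (∑ ((s ◃ 1) • e a) +_) (∑-+ ((t ◃ 1) • e b) 0v) ⟩
  ∑ ((s ◃ 1) • e a) + (∑ ((t ◃ 1) • e b) + ∑ {N} 0v)     ≡⟨ cong₂ (λ x y → x + (y + ∑ {N} 0v)) (∑-signed-e s a) (∑-signed-e t b) ⟩
  (s ◃ 1) + ((t ◃ 1) + ∑ {N} 0v)                         ≡⟨ cong (λ x → (s ◃ 1) + ((t ◃ 1) + x)) (∑-zero {N} (λ _ → refl)) ⟩
  (s ◃ 1) + ((t ◃ 1) + 0ℤ)                               ∎
  where open ≡-Reasoning

root-classification : ∀ {N} (d : Vecℤ N) → dot d d ≡ ℤ.+ 2 → ∑ d ≡ 0ℤ → ∃₂ λ a b → d ≈ root a b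
root-classification d d·d≡2 ∑d≡0
  with signed-unit-decomposition d (ℤP.+-injective (trans (sym (dot-self d)) d·d≡2)) (s≤s (s≤s (s≤s z≤n)))
... | (s , a) ∷ (t , b) ∷ [] , d≈ =
  signs s t (trans (sym (∑-signedSum₂ s a t b)) (trans (sym (∑-cong d≈)) ∑d≡0)) d≈
  where
  signs : ∀ s t → (s ◃ 1) + ((t ◃ 1) + 0ℤ) ≡ 0ℤ → d ≈ signedSum ((s , a) ∷ (t , b) ∷ []) →
          ∃₂ λ a b → d ≈ root a b
  signs Sign.+ Sign.+ ()
  signs Sign.- Sign.- ()
  signs Sign.+ Sign.- _ d≈ = a , b , λ k → trans (d≈ k) (plus-minus (δ k a) (δ k b))
    where
    plus-minus : ∀ x y → 1ℤ * x + (-1ℤ * y + 0ℤ) ≡ x - y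
    plus-minus = solve-∀
  signs Sign.- Sign.+ _ d≈ = b , a , λ k → trans (d≈ k) (minus-plus (δ k a) (δ k b))
    where
    minus-plus : ∀ x y → -1ℤ * x + (1ℤ * y + 0ℤ) ≡ y - x
    minus-plus = solve-∀

Symmetric : ∀ {n} → Mat n n → Set
Symmetric A = ∀ i j → A i j ≡ A j i

dot-e-·-e : ∀ {n} (A : Mat n n) i j → dot (e i) (A · e j) ≡ A i j
dot-e-·-e A i j = trans (dot-eˡ (A · e j) i) (·-e A j i)

dot-·-symmetric : ∀ {n} {A : Mat n n} → Symmetric A → ∀ x y → dot x (A · y) ≡ dot y (A · x)
dot-·-symmetric {A = A} A-sym x y = begin
  dot x (A · y)         ≡⟨ dot-ᵀ A x y ⟩
  dot ((A ᵀ) · x) y     ≡⟨ dot-cong (·-congᴹ (λ i j → A-sym j i) x) (λ _ → refl) ⟩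
  dot (A · x) y         ≡⟨ dot-comm (A · x) y ⟩
  dot y (A · x)         ∎
  where open ≡-Reasoning

dot-·-+ : ∀ {n} {A : Mat n n} → Symmetric A → ∀ x y →
  dot (x +ᵛ y) (A · (x +ᵛ y)) ≡ dot x (A · x) + dot x (A · y) + (dot x (A · y) + dot y (A · y))
dot-·-+ {A = A} A-sym x y = begin
  dot (x +ᵛ y) (A · (x +ᵛ y))
    ≡⟨ dot-+ˡ x y (A · (x +ᵛ y)) ⟩
  dot x (A · (x +ᵛ y)) + dot y (A · (x +ᵛ y))
    ≡⟨ cong₂ _+_ (trans (dot-congʳ x (·-+ A x y)) (dot-+ʳ x (A · x) (A · y)))
                 (trans (dot-congʳ y (·-+ A x y)) (dot-+ʳ y (A · x) (A · y))) ⟩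
  dot x (A · x) + dot x (A · y) + (dot y (A · x) + dot y (A · y))
    ≡⟨ cong (λ s → dot x (A · x) + dot x (A · y) + (s + dot y (A · y))) (dot-·-symmetric A-sym y x) ⟩
  dot x (A · x) + dot x (A · y) + (dot x (A · y) + dot y (A · y))
    ∎
  where open ≡-Reasoning

symmetric-≡-from-diagonal : ∀ {n} {A B : Mat n n} → Symmetric A → Symmetric B →
  (∀ x → dot x (A · x) ≡ dot x (B · x)) → ∀ i j → A i j ≡ B i j
symmetric-≡-from-diagonal {A = A} {B} A-sym B-sym A≡B i j = ℤP.*-cancelˡ-≡ (ℤ.+ 2) (A i j) (B i j) (begin
  ℤ.+ 2 * A i j                               ≡⟨ middle (A i i) (A i j) (A j j) ⟩
  expand A - A i i - A j j                    ≡⟨ cong₂ (λ s t → expand A - s - t) (diagonal i) (diagonal j) ⟩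
  expand A - B i i - B j j                    ≡⟨ cong (λ s → s - B i i - B j j) expand-≡ ⟩
  expand B - B i i - B j j                    ≡⟨ sym (middle (B i i) (B i j) (B j j)) ⟩
  ℤ.+ 2 * B i j                               ∎)
  where
  open ≡-Reasoning
  expand : Mat _ _ → ℤ
  expand M = M i i + M i j + (M i j + M j j)
  middle : ∀ p x q → ℤ.+ 2 * x ≡ p + x + (x + q) - p - q
  middle = solve-∀
  diagonal : ∀ k → A k k ≡ B k k
  diagonal k = trans (sym (dot-e-·-e A k k)) (trans (A≡B (e k)) (dot-e-·-e B k k))
  expansion : ∀ {M} → Symmetric M → dot (e i +ᵛ e j) (M · (e i +ᵛ e j)) ≡ expand M
  expansion {M} M-sym = trans (dot-·-+ M-sym (e i) (e j))
    (cong₂ (λ s t → s + t) (cong₂ _+_ (dot-e-·-e M i i) (dot-e-·-e M i j))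
                           (cong₂ _+_ (dot-e-·-e M i j) (dot-e-·-e M j j)))
  expand-≡ : expand A ≡ expand B
  expand-≡ = trans (sym (expansion A-sym)) (trans (A≡B (e i +ᵛ e j)) (expansion B-sym))

ᵀ⊗-symmetric : ∀ {m n} (Q : Mat m n) → Symmetric ((Q ᵀ) ⊗ Q)
ᵀ⊗-symmetric Q i j = ∑-cong (λ k → ℤP.*-comm (Q k i) (Q k j))

dot-·-ᵀ⊗ : ∀ {m n} (Q : Mat m n) (x : Vecℤ n) → dot x (((Q ᵀ) ⊗ Q) · x) ≡ dot (Q · x) (Q · x)
dot-·-ᵀ⊗ Q x = trans (dot-congʳ x (⊗-· (Q ᵀ) Q x)) (dot-ᵀ (Q ᵀ) x (Q · x))

gram-from-quadratic : ∀ {m n} {A : Mat n n} → Symmetric A → (Q : Mat m n) →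
  (∀ x → dot x (A · x) ≡ dot (Q · x) (Q · x)) → ∀ i j → A i j ≡ ((Q ᵀ) ⊗ Q) i j
gram-from-quadratic A-sym Q A≡QᵀQ =
  symmetric-≡-from-diagonal A-sym (ᵀ⊗-symmetric Q) (λ x → trans (A≡QᵀQ x) (sym (dot-·-ᵀ⊗ Q x)))

⊕ᵀ-symmetric : ∀ {n} (A : Mat n n) → Symmetric (A ⊕ (A ᵀ))
⊕ᵀ-symmetric A i j = ℤP.+-comm (A i j) (A j i)

dot-·-⊕ᵀ : ∀ {n} (A : Mat n n) (x : Vecℤ n) → dot x ((A ⊕ (A ᵀ)) · x) ≡ bil A x x + bil A x x
dot-·-⊕ᵀ A x = begin
  dot x ((A ⊕ (A ᵀ)) · x)              ≡⟨ dot-congʳ x (·-⊕ A (A ᵀ) x) ⟩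
  dot x ((A · x) +ᵛ ((A ᵀ) · x))       ≡⟨ dot-+ʳ x (A · x) ((A ᵀ) · x) ⟩
  dot x (A · x) + dot x ((A ᵀ) · x)    ≡⟨ cong (dot x (A · x) +_) (trans (dot-ᵀ (A ᵀ) x x) (dot-comm (A · x) x)) ⟩
  dot x (A · x) + dot x (A · x)        ∎
  where open ≡-Reasoning

-- The root system 𝔸_r

pathRoots : ∀ r → Fin r → Fin (suc r) × Fin (suc r)
pathRoots r i = inject₁ i , suc i

ǦA-δℕ : ∀ r (i j : Fin r) → ǦA r i j ≡ δℕ (toℕ i) (toℕ j) - δℕ (suc (toℕ i)) (toℕ j)
ǦA-δℕ r i j with toℕ i ℕ.≟ toℕ j
... | yes i≡j = sym (cong₂ _-_ (δℕ-≡ i≡j) (δℕ-≢ (λ 1+i≡j → ℕP.1+n≢n (trans 1+i≡j (sym i≡j)))))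
... | no  i≢j with suc (toℕ i) ℕ.≟ toℕ j
...   | yes 1+i≡j = sym (cong₂ _-_ (δℕ-≢ i≢j) (δℕ-≡ 1+i≡j))
...   | no  1+i≢j = sym (cong₂ _-_ (δℕ-≢ i≢j) (δℕ-≢ 1+i≢j))

pathGram : ∀ r (i j : Fin r) → ((rootMatrix (pathRoots r) ᵀ) ⊗ rootMatrix (pathRoots r)) i j ≡ (ǦA r ⊕ (ǦA r ᵀ)) i j
pathGram r i j = begin
  dot (root (inject₁ i) (suc i)) (column J j)
    ≡⟨ dot-rootˡ (inject₁ i) (suc i) (column J j) ⟩
  (δ (inject₁ i) (inject₁ j) - δ (inject₁ i) (suc j)) - (δ (suc i) (inject₁ j) - δ (suc i) (suc j))
    ≡⟨ cong₂ (λ s t → (s - t) - (δ (suc i) (inject₁ j) - δ (suc i) (suc j)))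
             (cong₂ δℕ (FP.toℕ-inject₁ i) (FP.toℕ-inject₁ j)) (cong (λ s → δℕ s (suc (toℕ j))) (FP.toℕ-inject₁ i)) ⟩
  (A - B) - (δℕ (suc (toℕ i)) (toℕ (inject₁ j)) - A)
    ≡⟨ cong (λ s → (A - B) - (δℕ (suc (toℕ i)) s - A)) (FP.toℕ-inject₁ j) ⟩
  (A - B) - (C - A)
    ≡⟨ regroup A B C ⟩
  (A - C) + (A - B)
    ≡⟨ cong₂ (λ s t → (A - C) + (s - t)) (δℕ-sym (toℕ i) (toℕ j)) (δℕ-sym (toℕ i) (suc (toℕ j))) ⟩
  (A - C) + (δℕ (toℕ j) (toℕ i) - δℕ (suc (toℕ j)) (toℕ i))
    ≡⟨ sym (cong₂ _+_ (ǦA-δℕ r i j) (ǦA-δℕ r j i)) ⟩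
  ǦA r i j + ǦA r j i
    ∎
  where
  open ≡-Reasoning
  J = rootMatrix (pathRoots r)
  A = δℕ (toℕ i) (toℕ j)
  B = δℕ (toℕ i) (suc (toℕ j))
  C = δℕ (suc (toℕ i)) (toℕ j)
  regroup : ∀ a b c → (a - b) - (c - a) ≡ (a - c) + (a - b)
  regroup = solve-∀

path-norm : ∀ r (y : Vecℤ r) → dot (rootMatrix (pathRoots r) · y) (rootMatrix (pathRoots r) · y) ≡ qA r y + qA r y
path-norm r y = begin
  dot (J · y) (J · y)                  ≡⟨ sym (dot-·-ᵀ⊗ J y) ⟩
  dot y (((J ᵀ) ⊗ J) · y)              ≡⟨ dot-congʳ y (·-congᴹ (pathGram r) y) ⟩
  dot y ((ǦA r ⊕ (ǦA r ᵀ)) · y)        ≡⟨ dot-·-⊕ᵀ (ǦA r) y ⟩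
  qA r y + qA r y                      ∎
  where
  open ≡-Reasoning
  J = rootMatrix (pathRoots r)

suffixSums : ∀ {r} → Vecℤ r → Vecℤ (suc r)
suffixSums {zero}  w _       = 0ℤ
suffixSums {suc r} w zero    = w zero + suffixSums (w ∘ suc) zero
suffixSums {suc r} w (suc k) = suffixSums (w ∘ suc) k

suffixSums-step : ∀ {r} (w : Vecℤ r) (i : Fin r) → suffixSums w (inject₁ i) - suffixSums w (suc i) ≡ w i
suffixSums-step {suc r} w zero    = plus-minus (w zero) (suffixSums (w ∘ suc) zero)
  where
  plus-minus : ∀ a b → (a + b) - b ≡ a
  plus-minus = solve-∀
suffixSums-step {suc r} w (suc i) = suffixSums-step (w ∘ suc) i

path-ᵀ-surjective : ∀ r (w : Vecℤ r) → ((rootMatrix (pathRoots r) ᵀ) · suffixSums w) ≈ w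
path-ᵀ-surjective r w i = trans (dot-rootˡ (inject₁ i) (suc i) (suffixSums w)) (suffixSums-step w i)

-- Kernels of surjections

module _ {r n : ℕ} (P : Mat r n) where

  right-inverse : (∀ y → ∃ λ x → (P · x) ≈ y) → Σ (Mat n r) λ S → ∀ w → (P · (S · w)) ≈ w
  right-inverse P-onto = S , PS≈id
    where
    S : Mat n r
    S i j = proj₁ (P-onto (e j)) i
    PS≈id : ∀ w → (P · (S · w)) ≈ w
    PS≈id w k = begin
      (P · (S · w)) k                      ≡⟨ sym (⊗-· P S w k) ⟩
      ∑ (λ j → (P · column S j) k * w j)   ≡⟨ ∑-cong (λ j → cong (_* w j) (trans (proj₂ (P-onto (e j)) k) (δ-sym k j))) ⟩
      ∑ (λ j → δ j k * w j)                ≡⟨ ∑-δˡ w k ⟩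
      w k                                  ∎
      where open ≡-Reasoning

  module _ (S : Mat n r) (PS≈id : ∀ w → (P · (S · w)) ≈ w) where

    projection : Vecℤ n → Vecℤ n
    projection v = v -ᵛ (S · (P · v))

    projection-∈-kernel : ∀ v → (P · projection v) ≈ 0v
    projection-∈-kernel v k = trans (·-- P v (S · (P · v)) k)
                                    (trans (cong (λ s → (P · v) k - s) (PS≈id (P · v) k)) (ℤP.+-inverseʳ ((P · v) k)))

    annihilator-⊆-image-ᵀ : ∀ h → (∀ v → (P · v) ≈ 0v → dot h v ≡ 0ℤ) → h ≈ ((P ᵀ) · ((S ᵀ) · h))
    annihilator-⊆-image-ᵀ h h⊥ker i = begin
      h i                                               ≡⟨ sym (dot-eʳ h i) ⟩
      dot h (e i)                                       ≡⟨ dot-congʳ h (λ l → minus-plus (e i l) (SPe l)) ⟩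
      dot h (projection (e i) +ᵛ SPe)                   ≡⟨ dot-+ʳ h (projection (e i)) SPe ⟩
      dot h (projection (e i)) + dot h SPe              ≡⟨ cong (_+ dot h SPe) (h⊥ker (projection (e i)) (projection-∈-kernel (e i))) ⟩
      0ℤ + dot h SPe                                    ≡⟨ ℤP.+-identityˡ (dot h SPe) ⟩
      dot h (S · (P · e i))                             ≡⟨ dot-ᵀ S h (P · e i) ⟩
      dot ((S ᵀ) · h) (P · e i)                         ≡⟨ dot-ᵀ P ((S ᵀ) · h) (e i) ⟩
      dot ((P ᵀ) · ((S ᵀ) · h)) (e i)                   ≡⟨ dot-eʳ ((P ᵀ) · ((S ᵀ) · h)) i ⟩
      ((P ᵀ) · ((S ᵀ) · h)) i                           ∎
      where
      open ≡-Reasoning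
      SPe = S · (P · e i)
      minus-plus : ∀ a b → a ≡ (a - b) + b
      minus-plus = solve-∀

    ·-projection-columns : ∀ {c} (K : Mat n c) (R : Mat c n) →
      (∀ i → (K · column R i) ≈ projection (e i)) → ∀ x → (K · (R · x)) ≈ projection x
    ·-projection-columns K R KRᵢ≈ x l = begin
      (K · (R · x)) l                                        ≡⟨ sym (⊗-· K R x l) ⟩
      ∑ (λ i → (K · column R i) l * x i)                     ≡⟨ ∑-cong (λ i → cong (_* x i) (KRᵢ≈ i l)) ⟩
      ∑ (λ i → (δ l i - (S · (P · e i)) l) * x i)            ≡⟨ ∑-cong (λ i → *-distribʳ-- (x i) (δ l i) ((S · (P · e i)) l)) ⟩
      ∑ (λ i → δ l i * x i - (S · (P · e i)) l * x i)        ≡⟨ ∑-- (λ i → δ l i * x i) (λ i → (S · (P · e i)) l * x i) ⟩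
      ∑ (λ i → δ l i * x i) - ∑ (λ i → (S · (P · e i)) l * x i)
        ≡⟨ cong₂ _-_ (trans (∑-cong (λ i → cong (_* x i) (δ-sym l i))) (∑-δˡ x l))
                     (∑-cong (λ i → cong (_* x i) (trans (sym (⊗-· S P (e i) l)) (·-e (S ⊗ P) i l)))) ⟩
      x l - ((S ⊗ P) · x) l                                  ≡⟨ cong (λ s → x l - s) (⊗-· S P x l) ⟩
      x l - (S · (P · x)) l                                  ∎
      where
      open ≡-Reasoning
      *-distribʳ-- : ∀ a b c → (b - c) * a ≡ b * a - c * a
      *-distribʳ-- = solve-∀

    kernel-retraction : ∀ {c} (K : Mat n c) → (∀ y → (P · (K · y)) ≈ 0v) → (∀ y → (K · y) ≈ 0v → y ≈ 0v) →
      (∀ v → (P · v) ≈ 0v → ∃ λ y → (K · y) ≈ v) → Σ (Mat c n) λ R → ∀ y → (R · (K · y)) ≈ y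
    kernel-retraction {c} K PK≈0 K-injective K-onto = R , RK≈id
      where
      preimage : ∀ i → ∃ λ y → (K · y) ≈ projection (e i)
      preimage i = K-onto (projection (e i)) (projection-∈-kernel (e i))
      R : Mat c n
      R b i = proj₁ (preimage i) b
      RK≈id : ∀ y → (R · (K · y)) ≈ y
      RK≈id y b = ℤP.i-j≡0⇒i≡j _ _ (K-injective ((R · (K · y)) -ᵛ y) K[RKy-y]≈0 b)
        where
        open ≡-Reasoning
        K[RKy-y]≈0 : (K · ((R · (K · y)) -ᵛ y)) ≈ 0v
        K[RKy-y]≈0 l = begin
          (K · ((R · (K · y)) -ᵛ y)) l               ≡⟨ ·-- K (R · (K · y)) y l ⟩
          (K · (R · (K · y))) l - (K · y) l          ≡⟨ cong (_- (K · y) l) (·-projection-columns K R (proj₂ ∘ preimage) (K · y) l) ⟩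
          ((K · y) l - (S · (P · (K · y))) l) - (K · y) l
            ≡⟨ cong (λ s → ((K · y) l - s) - (K · y) l) (trans (·-cong S (PK≈0 y) l) (·-0 S l)) ⟩
          ((K · y) l - 0ℤ) - (K · y) l               ≡⟨ cancel ((K · y) l) ⟩
          0ℤ                                         ∎
          where
          cancel : ∀ a → (a - 0ℤ) - a ≡ 0ℤ
          cancel = solve-∀

left-inverse⇒ᵀ-surjective : ∀ {n c} (K : Mat n c) (R : Mat c n) → (∀ y → (R · (K · y)) ≈ y) →
  ∀ x → ((K ᵀ) · ((R ᵀ) · x)) ≈ x
left-inverse⇒ᵀ-surjective K R RK≈id x b = begin
  ((K ᵀ) · ((R ᵀ) · x)) b      ≡⟨ ᵀ-· K ((R ᵀ) · x) b ⟩
  dot (K · e b) ((R ᵀ) · x)    ≡⟨ dot-ᵀ (R ᵀ) (K · e b) x ⟩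
  dot (R · (K · e b)) x        ≡⟨ dot-cong (RK≈id (e b)) (λ _ → refl) ⟩
  dot (e b) x                  ≡⟨ dot-eˡ x b ⟩
  x b                          ∎
  where open ≡-Reasoning

-- Purity of the restricted morsification

x-y≡k*a⇒x%a≡y%a : ∀ x y a k .{{_ : NonZero a}} → x - y ≡ k * a → x % a ≡ y % a
x-y≡k*a⇒x%a≡y%a x y a k x-y≡ka = ℤP.+-injective (ℤP.i-j≡0⇒i≡j (ℤ.+ r) (ℤ.+ r′) (ℤP.∣i∣≡0⇒i≡0 ∣r-r′∣≡0))
  where
  r = x % a
  r′ = y % a
  q = x / a
  q′ = y / a
  m = ∣ k - q + q′ ∣
  r-r′≡ : ℤ.+ r - ℤ.+ r′ ≡ (k - q + q′) * a
  r-r′≡ = begin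
    ℤ.+ r - ℤ.+ r′                                          ≡⟨ regroup (ℤ.+ r) (ℤ.+ r′) q q′ a ⟩
    ((ℤ.+ r + q * a) - (ℤ.+ r′ + q′ * a)) - q * a + q′ * a
      ≡⟨ cong₂ (λ s t → (s - t) - q * a + q′ * a) (sym (a≡a%n+[a/n]*n x a)) (sym (a≡a%n+[a/n]*n y a)) ⟩
    (x - y) - q * a + q′ * a                                ≡⟨ cong (λ s → s - q * a + q′ * a) x-y≡ka ⟩
    k * a - q * a + q′ * a                                  ≡⟨ factor k q q′ a ⟩
    (k - q + q′) * a                                        ∎
    where
    open ≡-Reasoning
    regroup : ∀ s t u v w → s - t ≡ ((s + u * w) - (t + v * w)) - u * w + v * w
    regroup = solve-∀
    factor : ∀ s t u w → s * w - t * w + u * w ≡ (s - t + u) * w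
    factor = solve-∀
  ∣r-r′∣<∣a∣ : ∣ ℤ.+ r - ℤ.+ r′ ∣ ℕ.< ∣ a ∣
  ∣r-r′∣<∣a∣ = begin-strict
    ∣ ℤ.+ r - ℤ.+ r′ ∣ ≡⟨ cong ∣_∣ (ℤP.[+m]-[+n]≡m⊖n r r′) ⟩
    ∣ r ℤ.⊖ r′ ∣      ≤⟨ ℤP.∣m⊝n∣≤m⊔n r r′ ⟩
    r ℕ.⊔ r′          <⟨ ℕP.⊔-lub (n%d<d x a) (n%d<d y a) ⟩
    ∣ a ∣             ∎
    where open ℕP.≤-Reasoning
  m≡0 : m ≡ 0
  m≡0 = ℕP.n<1⇒n≡0 (ℕP.*-cancelʳ-< ∣ a ∣ m 1 (begin-strict
    m ℕ.* ∣ a ∣        ≡⟨ sym (ℤP.abs-* (k - q + q′) a) ⟩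
    ∣ (k - q + q′) * a ∣ ≡⟨ cong ∣_∣ (sym r-r′≡) ⟩
    ∣ ℤ.+ r - ℤ.+ r′ ∣ <⟨ ∣r-r′∣<∣a∣ ⟩
    ∣ a ∣              ≡⟨ sym (ℕP.+-identityʳ ∣ a ∣) ⟩
    1 ℕ.* ∣ a ∣        ∎))
    where open ℕP.≤-Reasoning
  ∣r-r′∣≡0 : ∣ ℤ.+ r - ℤ.+ r′ ∣ ≡ 0
  ∣r-r′∣≡0 = trans (cong ∣_∣ r-r′≡) (trans (ℤP.abs-* (k - q + q′) a) (cong (ℕ._* ∣ a ∣) m≡0))

-- u i and u (σ i) are congruent modulo a, so they have the same remainder and their
-- quotients by a differ by exactly v i.
shift-image-pure : ∀ {I : Set} (σ : I → I) (a : ℤ) .{{_ : NonZero a}} (u v : I → ℤ) →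
  (∀ i → a * v i ≡ u i - u (σ i)) → ∀ i → v i ≡ u i / a - u (σ i) / a
shift-image-pure σ a u v av≡ i = ℤP.*-cancelˡ-≡ a (v i) (q - q′) (begin
  a * v i                                      ≡⟨ av≡ i ⟩
  u i - u (σ i)                                ≡⟨ cong₂ _-_ (a≡a%n+[a/n]*n (u i) a) (a≡a%n+[a/n]*n (u (σ i)) a) ⟩
  (ℤ.+ r + q * a) - (ℤ.+ r′ + q′ * a)          ≡⟨ cong (λ s → (ℤ.+ r + q * a) - (ℤ.+ s + q′ * a)) (sym r≡r′) ⟩
  (ℤ.+ r + q * a) - (ℤ.+ r + q′ * a)           ≡⟨ cancel (ℤ.+ r) q q′ a ⟩
  a * (q - q′)                                 ∎)
  where
  open ≡-Reasoning
  r = u i % a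
  r′ = u (σ i) % a
  q = u i / a
  q′ = u (σ i) / a
  r≡r′ : r ≡ r′
  r≡r′ = x-y≡k*a⇒x%a≡y%a (u i) (u (σ i)) a (v i) (trans (sym (av≡ i)) (ℤP.*-comm a (v i)))
  cancel : ∀ s t t′ w → (s + t * w) - (s + t′ * w) ≡ w * (t - t′)
  cancel = solve-∀

ᵀ-·-≈0⇒⊥ : ∀ {n c} (K : Mat n c) (h : Vecℤ n) → ((K ᵀ) · h) ≈ 0v → ∀ y → dot h (K · y) ≡ 0ℤ
ᵀ-·-≈0⇒⊥ K h Kᵀh≈0 y = trans (dot-ᵀ K h y) (trans (dot-cong Kᵀh≈0 (λ _ → refl)) (dot-0ˡ y))

ᵀ-·-ᵀ-≈0 : ∀ {N n c} (D : Mat N n) (K : Mat n c) → (∀ y → (D · (K · y)) ≈ 0v) →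
  ∀ t → ((K ᵀ) · ((D ᵀ) · t)) ≈ 0v
ᵀ-·-ᵀ-≈0 D K DK≈0 t b = begin
  ((K ᵀ) · ((D ᵀ) · t)) b     ≡⟨ ᵀ-· K ((D ᵀ) · t) b ⟩
  dot (K · e b) ((D ᵀ) · t)   ≡⟨ dot-ᵀ (D ᵀ) (K · e b) t ⟩
  dot (D · (K · e b)) t       ≡⟨ dot-cong (DK≈0 (e b)) (λ _ → refl) ⟩
  dot 0v t                    ≡⟨ dot-0ˡ t ⟩
  0ℤ                          ∎
  where open ≡-Reasoning

module _ {N n : ℕ} (G : Mat n n) (G-unit : UnitUpperTriangular G) (ab : Fin n → Fin N × Fin N)
         (G≡DᵀD : ∀ i j → i F.< j → G i j ≡ ((rootMatrix ab ᵀ) ⊗ rootMatrix ab) i j) where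

  private
    D = rootMatrix ab
    σ = rootPerm ab

  coxeter-roots : ∀ v w → (G · v) ≈ ((D ᵀ) · w) → (D · v) ≈ (λ k → w k - w (σ k))
  coxeter-roots v w Gv≈Dᵀw k =
    trans (coxeter-identity G G-unit D G≡DᵀD v w Gv≈Dᵀw k) (cong (λ s → w k - s) (coxeter-rootMatrix ab w k))

  divide-modulo-roots : ∀ a → a ≢ 0ℤ → ∀ g u w → (D · u) ≈ 0v → ((a • g) -ᵛ (G · u)) ≈ ((D ᵀ) · w) →
    ∃₂ λ v t → (D · v) ≈ 0v × (G · v) ≈ (g -ᵛ ((D ᵀ) · t))
  divide-modulo-roots a a≢0 g u w Du≈0 ag-Gu≈Dᵀw = v₀ -ᵛ v₁ , t , Dv≈0 , Gv≈g-Dᵀt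
    where
    instance _ = ℤ.≢-nonZero a≢0
    v₀ = proj₁ (unitUpper-solve G G-unit g)
    Gv₀≈g = proj₂ (unitUpper-solve G G-unit g)
    aDv₀≈ : ∀ k → a * (D · v₀) k ≡ w k - w (σ k)
    aDv₀≈ k = begin
      a * (D · v₀) k                          ≡⟨ sym (ℤP.+-identityʳ (a * (D · v₀) k)) ⟩
      a * (D · v₀) k - 0ℤ                     ≡⟨ cong₂ _-_ (sym (·-• D a v₀ k)) (sym (Du≈0 k)) ⟩
      (D · (a • v₀)) k - (D · u) k            ≡⟨ sym (·-- D (a • v₀) u k) ⟩
      (D · ((a • v₀) -ᵛ u)) k                 ≡⟨ coxeter-roots ((a • v₀) -ᵛ u) w G[av₀-u]≈Dᵀw k ⟩
      w k - w (σ k)                           ∎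
      where
      open ≡-Reasoning
      G[av₀-u]≈Dᵀw : (G · ((a • v₀) -ᵛ u)) ≈ ((D ᵀ) · w)
      G[av₀-u]≈Dᵀw i = trans (·-- G (a • v₀) u i)
        (trans (cong (_- (G · u) i) (trans (·-• G a v₀ i) (cong (a *_) (Gv₀≈g i)))) (ag-Gu≈Dᵀw i))
    t : Vecℤ N
    t k = w k / a
    v₁ = proj₁ (unitUpper-solve G G-unit ((D ᵀ) · t))
    Gv₁≈Dᵀt = proj₂ (unitUpper-solve G G-unit ((D ᵀ) · t))
    Dv≈0 : (D · (v₀ -ᵛ v₁)) ≈ 0v
    Dv≈0 k = trans (·-- D v₀ v₁ k)
      (trans (cong₂ _-_ (shift-image-pure σ a w (D · v₀) aDv₀≈ k) (coxeter-roots v₁ t Gv₁≈Dᵀt k))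
             (ℤP.+-inverseʳ (t k - t (σ k))))
    Gv≈g-Dᵀt : (G · (v₀ -ᵛ v₁)) ≈ (g -ᵛ ((D ᵀ) · t))
    Gv≈g-Dᵀt k = trans (·-- G v₀ v₁ k) (cong₂ _-_ (Gv₀≈g k) (Gv₁≈Dᵀt k))

record RootPresentation {n : ℕ} (q : UnitForm n) (N : ℕ) : Set where
  field
    roots       : Fin n → Fin N × Fin N
    upper-gram  : ∀ i j → i F.< j → Ǧ q i j ≡ ((rootMatrix roots ᵀ) ⊗ rootMatrix roots) i j
    rad⇒kernel  : ∀ v → InRad q v → (rootMatrix roots · v) ≈ 0v
    kernel⇒rad  : ∀ v → (rootMatrix roots · v) ≈ 0v → InRad q v
    annihilator : ∀ h → (∀ v → InRad q v → dot h v ≡ 0ℤ) → ∃ λ w → h ≈ ((rootMatrix roots ᵀ) · w)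

restrGram-· : ∀ {n c} (q : UnitForm n) (K : Mat n c) (y : Vecℤ c) →
  (restrGram q K · y) ≈ ((K ᵀ) · (Ǧ q · (K · y)))
restrGram-· q K y b = trans (⊗-· (K ᵀ) (Ǧ q ⊗ K) y b) (·-cong (K ᵀ) (⊗-· (Ǧ q) K y) b)

restrGram-pure : ∀ {n N c} (q : UnitForm n) → RootPresentation q N → (K : Mat n c) → RadBasis q c K →
  (∀ x → ∃ λ g → ((K ᵀ) · g) ≈ x) → PureMat (restrGram q K)
restrGram-pure q pres K (K-rad , _ , K-span) Kᵀ-onto a x a≢0 (y , Wy≈ax) = z , Wz≈x
  where
  open RootPresentation pres
  D = rootMatrix roots
  G = Ǧ q
  g = proj₁ (Kᵀ-onto x)
  Kᵀg≈x = proj₂ (Kᵀ-onto x)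
  DK≈0 : ∀ y → (D · (K · y)) ≈ 0v
  DK≈0 y = rad⇒kernel (K · y) (K-rad y)
  h = (a • g) -ᵛ (G · (K · y))
  Kᵀh≈0 : ((K ᵀ) · h) ≈ 0v
  Kᵀh≈0 b = begin
    ((K ᵀ) · h) b                                         ≡⟨ ·-- (K ᵀ) (a • g) (G · (K · y)) b ⟩
    ((K ᵀ) · (a • g)) b - ((K ᵀ) · (G · (K · y))) b      ≡⟨ cong₂ _-_ (trans (·-• (K ᵀ) a g b) (cong (a *_) (Kᵀg≈x b)))
                                                                      (trans (sym (restrGram-· q K y b)) (Wy≈ax b)) ⟩
    a * x b - a * x b                                     ≡⟨ ℤP.+-inverseʳ (a * x b) ⟩
    0ℤ                                                    ∎
    where open ≡-Reasoning
  h⊥rad : ∀ v → InRad q v → dot h v ≡ 0ℤ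
  h⊥rad v v∈rad = trans (dot-congʳ h (λ l → sym (proj₂ (K-span v v∈rad) l)))
                        (ᵀ-·-≈0⇒⊥ K h Kᵀh≈0 (proj₁ (K-span v v∈rad)))
  division = divide-modulo-roots G (diag q , upper q) roots upper-gram a a≢0 g (K · y)
           (proj₁ (annihilator h h⊥rad)) (DK≈0 y) (proj₂ (annihilator h h⊥rad))
  v = proj₁ division
  t = proj₁ (proj₂ division)
  Dv≈0 = proj₁ (proj₂ (proj₂ division))
  Gv≈g-Dᵀt = proj₂ (proj₂ (proj₂ division))
  z = proj₁ (K-span v (kernel⇒rad v Dv≈0))
  Kz≈v = proj₂ (K-span v (kernel⇒rad v Dv≈0))
  Wz≈x : (restrGram q K · z) ≈ x
  Wz≈x b = begin
    (restrGram q K · z) b                              ≡⟨ restrGram-· q K z b ⟩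
    ((K ᵀ) · (G · (K · z))) b                          ≡⟨ ·-cong (K ᵀ) (λ l → trans (·-cong G Kz≈v l) (Gv≈g-Dᵀt l)) b ⟩
    ((K ᵀ) · (g -ᵛ ((D ᵀ) · t))) b                     ≡⟨ ·-- (K ᵀ) g ((D ᵀ) · t) b ⟩
    ((K ᵀ) · g) b - ((K ᵀ) · ((D ᵀ) · t)) b            ≡⟨ cong₂ _-_ (Kᵀg≈x b) (ᵀ-·-ᵀ-≈0 D K DK≈0 t b) ⟩
    x b - 0ℤ                                           ≡⟨ ℤP.+-identityʳ (x b) ⟩
    x b                                                ∎
    where open ≡-Reasoning

typeA-presentation : ∀ {n r} (q : UnitForm n) → DynkinTypeA q r → RootPresentation q (suc r)
typeA-presentation {n} {r} q (P , P-onto , P-kernel , q≡qA∘P) = record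
  { roots       = roots
  ; upper-gram  = upper-gram
  ; rad⇒kernel  = rad⇒kernel
  ; kernel⇒rad  = kernel⇒rad
  ; annihilator = annihilator
  }
  where
  J = rootMatrix (pathRoots r)
  Q = J ⊗ P
  Q-norm : ∀ x → dot x (Gram q · x) ≡ dot (Q · x) (Q · x)
  Q-norm x = begin
    dot x (Gram q · x)                ≡⟨ dot-·-⊕ᵀ (Ǧ q) x ⟩
    evalQ q x + evalQ q x             ≡⟨ cong₂ _+_ (q≡qA∘P x) (q≡qA∘P x) ⟩
    qA r (P · x) + qA r (P · x)       ≡⟨ sym (path-norm r (P · x)) ⟩
    dot (J · (P · x)) (J · (P · x))   ≡⟨ sym (dot-cong (⊗-· J P x) (⊗-· J P x)) ⟩
    dot (Q · x) (Q · x)               ∎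
    where open ≡-Reasoning
  Gram≡QᵀQ : ∀ i j → Gram q i j ≡ ((Q ᵀ) ⊗ Q) i j
  Gram≡QᵀQ = gram-from-quadratic (⊕ᵀ-symmetric (Ǧ q)) Q Q-norm
  column-root : ∀ i → ∃₂ λ a b → column Q i ≈ root a b
  column-root i = root-classification (column Q i)
    (trans (sym (Gram≡QᵀQ i i)) (cong₂ _+_ (diag q i) (diag q i)))
    (∑-rootMatrix-· (pathRoots r) (column P i))
  roots : Fin n → Fin (suc r) × Fin (suc r)
  roots i = proj₁ (column-root i) , proj₁ (proj₂ (column-root i))
  D = rootMatrix roots
  Q≡D : ∀ k i → Q k i ≡ D k i
  Q≡D k i = proj₂ (proj₂ (column-root i)) k
  upper-gram : ∀ i j → i F.< j → Ǧ q i j ≡ ((D ᵀ) ⊗ D) i j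
  upper-gram i j i<j = begin
    Ǧ q i j                 ≡⟨ sym (ℤP.+-identityʳ (Ǧ q i j)) ⟩
    Ǧ q i j + 0ℤ            ≡⟨ cong (Ǧ q i j +_) (sym (upper q j i i<j)) ⟩
    Gram q i j              ≡⟨ Gram≡QᵀQ i j ⟩
    ((Q ᵀ) ⊗ Q) i j         ≡⟨ ∑-cong (λ k → cong₂ _*_ (Q≡D k i) (Q≡D k j)) ⟩
    ((D ᵀ) ⊗ D) i j         ∎
    where open ≡-Reasoning
  rad⇒kernel : ∀ v → InRad q v → (D · v) ≈ 0v
  rad⇒kernel v v∈rad k = begin
    (D · v) k           ≡⟨ sym (·-congᴹ Q≡D v k) ⟩
    (Q · v) k           ≡⟨ ⊗-· J P v k ⟩
    (J · (P · v)) k     ≡⟨ ·-cong J (Equivalence.from (P-kernel v) v∈rad) k ⟩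
    (J · 0v) k          ≡⟨ ·-0 J k ⟩
    0ℤ                  ∎
    where open ≡-Reasoning
  kernel⇒rad : ∀ v → (D · v) ≈ 0v → InRad q v
  kernel⇒rad v Dv≈0 i = begin
    (Gram q · v) i          ≡⟨ ·-congᴹ Gram≡QᵀQ v i ⟩
    (((Q ᵀ) ⊗ Q) · v) i     ≡⟨ ⊗-· (Q ᵀ) Q v i ⟩
    ((Q ᵀ) · (Q · v)) i     ≡⟨ ·-cong (Q ᵀ) (λ k → trans (·-congᴹ Q≡D v k) (Dv≈0 k)) i ⟩
    ((Q ᵀ) · 0v) i          ≡⟨ ·-0 (Q ᵀ) i ⟩
    0ℤ                      ∎
    where open ≡-Reasoning
  annihilator : ∀ h → (∀ v → InRad q v → dot h v ≡ 0ℤ) → ∃ λ w → h ≈ ((D ᵀ) · w)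
  annihilator h h⊥rad = suffixSums s , λ i → begin
    h i                                      ≡⟨ h≈PᵀSᵀh i ⟩
    ((P ᵀ) · s) i                            ≡⟨ ·-cong (P ᵀ) (λ l → sym (path-ᵀ-surjective r s l)) i ⟩
    ((P ᵀ) · ((J ᵀ) · suffixSums s)) i       ≡⟨ sym (ᵀ-⊗-· J P (suffixSums s) i) ⟩
    ((Q ᵀ) · suffixSums s) i                 ≡⟨ ·-congᴹ (λ i k → Q≡D k i) (suffixSums s) i ⟩
    ((D ᵀ) · suffixSums s) i                 ∎
    where
    open ≡-Reasoning
    S = proj₁ (right-inverse P P-onto)
    s = (S ᵀ) · h
    h≈PᵀSᵀh : h ≈ ((P ᵀ) · s)
    h≈PᵀSᵀh = annihilator-⊆-image-ᵀ P S (proj₂ (right-inverse P P-onto)) h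
                (λ v Pv≈0 → h⊥rad v (Equivalence.to (P-kernel v) Pv≈0))

typeA-radical-ᵀ-surjective : ∀ {n r c} (q : UnitForm n) → DynkinTypeA q r → (K : Mat n c) → RadBasis q c K →
  ∀ x → ∃ λ g → ((K ᵀ) · g) ≈ x
typeA-radical-ᵀ-surjective q (P , P-onto , P-kernel , _) K (K-rad , K-injective , K-span) x =
  (R ᵀ) · x , left-inverse⇒ᵀ-surjective K R RK≈id x
  where
  S = proj₁ (right-inverse P P-onto)
  retraction = kernel-retraction P S (proj₂ (right-inverse P P-onto)) K
    (λ y → Equivalence.from (P-kernel (K · y)) (K-rad y)) K-injective
    (λ v Pv≈0 → K-span v (Equivalence.to (P-kernel v) Pv≈0))
  R = proj₁ retraction
  RK≈id = proj₂ retraction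

corollary4p8 : (r n : ℕ) → r ≥ 1 → (q : UnitForm n) →
    Connected q → NonNegative q → DynkinTypeA q r →
    (c : ℕ) (K : Mat n c) → RadBasis q c K → PureMat (restrGram q K)
corollary4p8 r n _ q _ _ typeA c K K-basis =
  restrGram-pure q (typeA-presentation q typeA) K K-basis (typeA-radical-ᵀ-surjective q typeA K K-basis)
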